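{- Let $X=MD(G,S_0,S_1,T_0,T_1)$ be a strongly connected mixed Cayley digraph with $\lambda(X)<\delta(X)$. Then any two distinct positive $\lambda$-atoms of $X$ are vertex disjoint, and any two distinct negative $\lambda$-atoms of $X$ are vertex disjoint.
   Context: $G$ is a finite group with identity $1_G$, $S_0,S_1\subseteq G\setminus\{1_G\}$, $T_0,T_1\subseteq G$. The mixed Cayley digraph $X=MD(G,S_0,S_1,T_0,T_1)$ has vertex set $G\times\{0,1\}$ and arcs $((g,i),(sg,i))$ for $g\in G$, $s\in S_i$, $i=0,1$; $((g,0),(tg,1))$ for $g\in G$, $t\in T_0$; and $((tg,1),(g,0))$ for $g\in G$, $t\in T_1$. $\delta(X)$ is the minimum, over all vertices, of all in-degrees and out-degrees. $\lambda(X)$ is the arc-connectivity: the minimum number of arcs whose removal leaves a digraph that is not strongly connected. For $A\subseteq V(X)$, $\omega^+(A)$ is the set of arcs from $A$ to $V(X)\setminus A$ and $\omega^-(A)$ the set of arcs from $V(X)\setminus A$ to $A$. A proper nonempty $A\subseteq V(X)$ is a positive (resp. negative) arc fragment if $|\omega^+(A)|=\lambda(X)$ (resp. $|\omega^-(A)|=\lambda(X)$); an arc fragment is a positive or negative arc fragment. A $\lambda$-atom is an arc fragment of least possible cardinality; it is positive (resp. negative) if it is a positive (resp. negative) arc fragment. -}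

module Defs where

open import Data.Nat using (ℕ; _≤_)
open import Data.Bool using (Bool; true; false; _∧_; not)
open import Data.Fin using (Fin; zero; suc)
open import Data.Fin.Subset using (Subset)
open import Data.Fin.Subset.Properties using (_∈?_)
open import Data.List using (List; length; filterᵇ; cartesianProduct; allFin)
open import Data.List.Membership.Propositional using (_∈_)
open import Data.List.Relation.Unary.All using (All)
open import Data.List.Relation.Unary.Unique.Propositional using (Unique)
open import Data.Product using (_×_; _,_; ∃; Σ)
open import Data.Sum using (_⊎_)
open import Relation.Nullary using (¬_; does)
open import Relation.Binary.PropositionalEquality using (_≡_)
open import Relation.Binary.Construct.Closure.ReflexiveTransitive using (Star)
open import Algebra.Structures using (IsGroup)

record FinGroup : Set where
  field
    n       : ℕ
    _∙_     : Fin n → Fin n → Fin n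
    ε       : Fin n
    _⁻¹     : Fin n → Fin n
    isGroup : IsGroup _≡_ _∙_ ε _⁻¹

module MD (G : FinGroup) (S₀ S₁ T₀ T₁ : Subset (FinGroup.n G)) where
  open FinGroup G

  V : Set
  V = Fin n × Fin 2

  -- arcB u v = true iff (u , v) is an arc:
  --  ((g,i),(sg,i)) for s ∈ Sᵢ ; ((g,0),(tg,1)) for t ∈ T₀ ; ((tg,1),(g,0)) for t ∈ T₁.
  -- "h = s g for some s ∈ S" is written as "h g⁻¹ ∈ S".
  arcB : V → V → Bool
  arcB (g , zero)     (h , zero)     = does ((h ∙ (g ⁻¹)) ∈? S₀)
  arcB (g , suc zero) (h , suc zero) = does ((h ∙ (g ⁻¹)) ∈? S₁)
  arcB (g , zero)     (h , suc zero) = does ((h ∙ (g ⁻¹)) ∈? T₀)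
  arcB (h , suc zero) (g , zero)     = does ((h ∙ (g ⁻¹)) ∈? T₁)

  Arc : V → V → Set
  Arc u v = arcB u v ≡ true

  vertices : List V
  vertices = cartesianProduct (allFin n) (allFin 2)

  vpairs : List (V × V)
  vpairs = cartesianProduct vertices vertices

  outdeg indeg : V → ℕ
  outdeg u = length (filterᵇ (λ v → arcB u v) vertices)
  indeg  v = length (filterᵇ (λ u → arcB u v) vertices)

  IsMinDegree : ℕ → Set
  IsMinDegree d = (∀ v → d ≤ outdeg v × d ≤ indeg v)
                × ∃ (λ v → outdeg v ≡ d ⊎ indeg v ≡ d)

  StronglyConnected : (V → V → Set) → Set
  StronglyConnected R = ∀ u v → Star R u v

  ArcMinus : List (V × V) → V → V → Set
  ArcMinus F u v = Arc u v × ¬ ((u , v) ∈ F)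

  ArcSet : List (V × V) → Set
  ArcSet F = Unique F × All (λ p → Arc (Data.Product.proj₁ p) (Data.Product.proj₂ p)) F

  IsArcConnectivity : ℕ → Set
  IsArcConnectivity k =
      Σ (List (V × V)) (λ F → ArcSet F × length F ≡ k × ¬ StronglyConnected (ArcMinus F))
    × (∀ F → ArcSet F → Data.Nat._<_ (length F) k → StronglyConnected (ArcMinus F))

  VSet : Set
  VSet = V → Bool

  size : VSet → ℕ
  size A = length (filterᵇ A vertices)

  ProperNonempty : VSet → Set
  ProperNonempty A = ∃ (λ v → A v ≡ true) × ∃ (λ v → A v ≡ false)

  ω⁺ ω⁻ : VSet → ℕ
  ω⁺ A = length (filterᵇ (λ p → A (Data.Product.proj₁ p) ∧ not (A (Data.Product.proj₂ p))
                                 ∧ arcB (Data.Product.proj₁ p) (Data.Product.proj₂ p)) vpairs)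
  ω⁻ A = length (filterᵇ (λ p → not (A (Data.Product.proj₁ p)) ∧ A (Data.Product.proj₂ p)
                                 ∧ arcB (Data.Product.proj₁ p) (Data.Product.proj₂ p)) vpairs)

  PosFragment NegFragment Fragment : ℕ → VSet → Set
  PosFragment l A = ProperNonempty A × ω⁺ A ≡ l
  NegFragment l A = ProperNonempty A × ω⁻ A ≡ l
  Fragment l A = PosFragment l A ⊎ NegFragment l A

  Atom PosAtom NegAtom : ℕ → VSet → Set
  Atom l A = Fragment l A × (∀ B → Fragment l B → size A ≤ size B)
  PosAtom l A = Atom l A × PosFragment l A
  NegAtom l A = Atom l A × NegFragment l A

  SameSet : VSet → VSet → Set
  SameSet A B = ∀ v → A v ≡ B v

  Disjoint : VSet → VSet → Set
  Disjoint A B = ∀ v → ¬ (A v ≡ true × B v ≡ true)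

-- The number |ω⁺(A)| of arcs leaving A is submodular, |ω⁺(A ∩ B)| + |ω⁺(A ∪ B)| ≤ |ω⁺(A)| + |ω⁺(B)|,
-- and since complementation exchanges ∩ and ∪, so is |ω⁻(A)| = |ω⁺(∁ A)|; every proper nonempty
-- set has at least λ leaving arcs. Let A ≠ B be positive λ-atoms sharing a vertex. If A ∪ B misses
-- a vertex, both A ∩ B and A ∪ B are proper and nonempty, so submodularity squeezes |ω⁺(A ∩ B)|
-- down to λ; then A ∩ B is a fragment inside the atoms A and B, and minimality forces
-- A = A ∩ B = B. Otherwise ∁ A ⊆ B, and ∁ A is a negative fragment, so minimality of B gives
-- B = ∁ A, which is disjoint from A. Negative atoms are handled symmetrically.
module Submission where

open import Defs
open import Data.Nat using (ℕ; _<_)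
open import Data.Fin.Subset using (Subset; _∉_)
open import Data.Product using (_×_)
open import Relation.Nullary using (¬_)

open import Data.Nat using (suc; _+_; _≤_)
open import Data.Nat.Properties using (+-suc; +-mono-≤; +-monoʳ-≤; +-cancelʳ-≤; +-comm; ≤-antisym; ≮⇒≥; module ≤-Reasoning)
open import Data.Bool using (Bool; true; false; _∧_; _∨_; not; T)
open import Data.Bool.Properties using (∧-assoc; ∧-comm; ∧-conicalˡ; ∧-conicalʳ; ∨-conicalˡ; not-involutive; ¬-not; T-≡; T?)
import Data.Bool.Properties as Bool
open import Data.List using (List; []; _∷_; length; filterᵇ)
open import Data.List.Membership.Propositional using (_∈_; lose)
open import Data.List.Membership.Propositional.Properties using (∈-filter⁺; ∈-filter⁻; ∈-cartesianProduct⁺; ∈-allFin)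
open import Data.List.Relation.Unary.Any using (any?; satisfied)
import Data.List.Relation.Unary.All as All
open import Data.List.Relation.Unary.Unique.Propositional using (Unique)
import Data.List.Relation.Unary.Unique.Propositional.Properties as Unique
import Data.List.Relation.Binary.Sublist.Propositional as Sublist
import Data.List.Relation.Binary.Sublist.Propositional.Properties as Sublist
open import Data.List.Relation.Binary.Pointwise using (Pointwise-≡⇒≡)
open import Data.List.Properties using (filter-≐)
open import Data.Product using (_,_; proj₁; proj₂; ∃; ∃₂)
open import Data.Sum using (_⊎_; inj₁; inj₂)
open import Function using (_∘_; Equivalence)
open import Relation.Nullary using (yes; no; contradiction)
open import Relation.Binary.PropositionalEquality using (_≡_; refl; sym; trans; cong; cong₂; subst)
open import Relation.Binary.Construct.Closure.ReflexiveTransitive using (Star; ε; _◅_)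

private
  variable
    X : Set
    A B C p q : X → Bool

infixr 6 _∩_
infixr 5 _∪_
infix 4 _⊆_

_∩_ _∪_ : (X → Bool) → (X → Bool) → X → Bool
(A ∩ B) x = A x ∧ B x
(A ∪ B) x = A x ∨ B x

∁ : (X → Bool) → X → Bool
∁ A x = not (A x)

_⊆_ : (X → Bool) → (X → Bool) → Set
A ⊆ B = ∀ {x} → A x ≡ true → B x ≡ true

∩-⊆ˡ : A ∩ B ⊆ A
∩-⊆ˡ {A = A} {B = B} {x} = ∧-conicalˡ (A x) (B x)

∩-⊆ʳ : A ∩ B ⊆ B
∩-⊆ʳ {A = A} {B = B} {x} = ∧-conicalʳ (A x) (B x)

⊆-antisym : A ⊆ B → B ⊆ A → ∀ x → A x ≡ B x
⊆-antisym {A = A} {B = B} A⊆B B⊆A x with A x in Ax | B x in Bx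
... | true  | true  = refl
... | false | false = refl
... | true  | false = trans (sym (A⊆B Ax)) Bx
... | false | true  = trans (sym Ax) (B⊆A Bx)

filterᵇ-cong : (∀ x → p x ≡ q x) → ∀ xs → filterᵇ p xs ≡ filterᵇ q xs
filterᵇ-cong {p = p} {q = q} p≗q =
  filter-≐ (T? ∘ p) (T? ∘ q) ((λ {x} → subst T (p≗q x)) , (λ {x} → subst T (sym (p≗q x))))

filterᵇ-∧ : ∀ (p q : X → Bool) xs → filterᵇ (λ x → q x ∧ p x) xs ≡ filterᵇ p (filterᵇ q xs)
filterᵇ-∧ p q []       = refl
filterᵇ-∧ p q (x ∷ xs) with q x
... | false = filterᵇ-∧ p q xs
... | true with p x
...   | true  = cong (x ∷_) (filterᵇ-∧ p q xs)
...   | false = filterᵇ-∧ p q xs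

+-sucʳ-cong : ∀ {a b c d} → a + b ≡ c + d → a + suc b ≡ c + suc d
+-sucʳ-cong {a} {b} {c} {d} e = trans (+-suc a b) (trans (cong suc e) (sym (+-suc c d)))

length-filterᵇ-∨+∧ : ∀ (p q : X → Bool) xs →
  length (filterᵇ (λ x → p x ∨ q x) xs) + length (filterᵇ (λ x → p x ∧ q x) xs)
    ≡ length (filterᵇ p xs) + length (filterᵇ q xs)
length-filterᵇ-∨+∧ p q [] = refl
length-filterᵇ-∨+∧ p q (x ∷ xs) with ih ← length-filterᵇ-∨+∧ p q xs | p x | q x
... | true  | true  = cong suc (+-sucʳ-cong ih)
... | true  | false = cong suc ih
... | false | true  = trans (cong suc ih) (sym (+-suc _ _))
... | false | false = ih

filterᵇ-sublist : p ⊆ q → ∀ xs → filterᵇ p xs Sublist.⊆ filterᵇ q xs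
filterᵇ-sublist {p = p} {q = q} p⊆q xs =
  Sublist.filter⁺ (T? ∘ p) (T? ∘ q) (λ { refl → lift }) (Sublist.⊆-refl {x = xs})
  where
  lift : ∀ {x} → T (p x) → T (q x)
  lift = Equivalence.from T-≡ ∘ p⊆q ∘ Equivalence.to T-≡

length-filterᵇ-mono : p ⊆ q → ∀ xs → length (filterᵇ p xs) ≤ length (filterᵇ q xs)
length-filterᵇ-mono p⊆q xs = Sublist.length-mono-≤ (filterᵇ-sublist p⊆q xs)

length-filterᵇ-≤⇒⊇ : p ⊆ q → ∀ {xs} → length (filterᵇ q xs) ≤ length (filterᵇ p xs) →
  ∀ {x} → x ∈ xs → q x ≡ true → p x ≡ true
length-filterᵇ-≤⇒⊇ {p = p} {q = q} p⊆q {xs} q≤p {x} x∈xs qx =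
  Equivalence.to T-≡ (proj₂ (∈-filter⁻ (T? ∘ p) {xs = xs} (subst (x ∈_) (sym p≡q) x∈q)))
  where
  σ : filterᵇ p xs Sublist.⊆ filterᵇ q xs
  σ = filterᵇ-sublist p⊆q xs
  p≡q : filterᵇ p xs ≡ filterᵇ q xs
  p≡q = Pointwise-≡⇒≡ (Sublist.to-≋ (≤-antisym (Sublist.length-mono-≤ σ) q≤p) σ)
  x∈q : x ∈ filterᵇ q xs
  x∈q = ∈-filter⁺ (T? ∘ q) x∈xs (Equivalence.from T-≡ qx)

star-exit : ∀ {R : X → X → Set} (C : X → Bool) {x y} → Star R x y →
  C x ≡ true → C y ≡ false → ∃₂ λ u v → R u v × C u ≡ true × C v ≡ false
star-exit C ε Cx Cy = contradiction (trans (sym Cx) Cy) λ ()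
star-exit C (_◅_ {j = z} r path) Cx Cy with C z in Cz
... | true  = star-exit C path Cz Cy
... | false = _ , z , r , Cx , Cz

leaves : (X → Bool) → X × X → Bool
leaves C e = C (proj₁ e) ∧ not (C (proj₂ e))

cut : List (X × X) → (X → Bool) → ℕ
cut E C = length (filterᵇ (leaves C) E)

cut-cong : ∀ E → (∀ x → A x ≡ B x) → cut E A ≡ cut E B
cut-cong E A≗B = cong length (filterᵇ-cong (λ e → cong₂ (λ a b → a ∧ not b) (A≗B (proj₁ e)) (A≗B (proj₂ e))) E)

-- An arc leaving A ∩ B or A ∪ B leaves A or B; one leaving both leaves both.
leaves-∩∨∪ : ∀ a b a′ b′ → (a ∧ b) ∧ not (a′ ∧ b′) ∨ (a ∨ b) ∧ not (a′ ∨ b′) ≡ true →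
  a ∧ not a′ ∨ b ∧ not b′ ≡ true
leaves-∩∨∪ true  b     false b′    _  = refl
leaves-∩∨∪ true  true  true  false _  = refl
leaves-∩∨∪ true  true  true  true  ()
leaves-∩∨∪ true  false true  b′    ()
leaves-∩∨∪ false b     false b′    e  = e
leaves-∩∨∪ false true  true  b′    ()
leaves-∩∨∪ false false true  b′    ()

leaves-∩∧∪ : ∀ a b a′ b′ → ((a ∧ b) ∧ not (a′ ∧ b′)) ∧ ((a ∨ b) ∧ not (a′ ∨ b′)) ≡ true →
  (a ∧ not a′) ∧ (b ∧ not b′) ≡ true
leaves-∩∧∪ false b     a′    b′    ()
leaves-∩∧∪ true  false a′    b′    ()
leaves-∩∧∪ true  true  true  true  ()
leaves-∩∧∪ true  true  true  false ()
leaves-∩∧∪ true  true  false b′    e = e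

cut-submodular : ∀ E (A B : X → Bool) → cut E (A ∩ B) + cut E (A ∪ B) ≤ cut E A + cut E B
cut-submodular E A B = begin
  cut E (A ∩ B) + cut E (A ∪ B)
    ≡⟨ length-filterᵇ-∨+∧ (leaves (A ∩ B)) (leaves (A ∪ B)) E ⟨
  length (filterᵇ (λ e → leaves (A ∩ B) e ∨ leaves (A ∪ B) e) E)
    + length (filterᵇ (λ e → leaves (A ∩ B) e ∧ leaves (A ∪ B) e) E)
    ≤⟨ +-mono-≤ (length-filterᵇ-mono (λ {e} → on-ends leaves-∩∨∪ e) E)
                (length-filterᵇ-mono (λ {e} → on-ends leaves-∩∧∪ e) E) ⟩
  length (filterᵇ (λ e → leaves A e ∨ leaves B e) E)
    + length (filterᵇ (λ e → leaves A e ∧ leaves B e) E)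
    ≡⟨ length-filterᵇ-∨+∧ (leaves A) (leaves B) E ⟩
  cut E A + cut E B ∎
  where
  open ≤-Reasoning
  on-ends : ∀ {R : Bool → Bool → Bool → Bool → Set} → (∀ a b a′ b′ → R a b a′ b′) →
    ∀ e → R (A (proj₁ e)) (B (proj₁ e)) (A (proj₂ e)) (B (proj₂ e))
  on-ends r (u , v) = r (A u) (B u) (A v) (B v)

cut-∁-submodular : ∀ E (A B : X → Bool) →
  cut E (∁ (A ∩ B)) + cut E (∁ (A ∪ B)) ≤ cut E (∁ A) + cut E (∁ B)
cut-∁-submodular E A B = begin
  cut E (∁ (A ∩ B)) + cut E (∁ (A ∪ B))
    ≡⟨ cong₂ _+_ (cut-cong E (λ x → not-∧ (A x) (B x))) (cut-cong E (λ x → not-∨ (A x) (B x))) ⟩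
  cut E (∁ A ∪ ∁ B) + cut E (∁ A ∩ ∁ B)
    ≡⟨ +-comm (cut E (∁ A ∪ ∁ B)) _ ⟩
  cut E (∁ A ∩ ∁ B) + cut E (∁ A ∪ ∁ B)
    ≤⟨ cut-submodular E (∁ A) (∁ B) ⟩
  cut E (∁ A) + cut E (∁ B) ∎
  where
  open ≤-Reasoning
  not-∧ : ∀ a b → not (a ∧ b) ≡ not a ∨ not b
  not-∧ true  b = refl
  not-∧ false b = refl
  not-∨ : ∀ a b → not (a ∨ b) ≡ not a ∧ not b
  not-∨ true  b = refl
  not-∨ false b = refl

module _ (G : FinGroup) (S₀ S₁ T₀ T₁ : Subset (FinGroup.n G)) where
  open MD G S₀ S₁ T₀ T₁

  private
    variable
      l : ℕ

  isArc : V × V → Bool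
  isArc e = arcB (proj₁ e) (proj₂ e)

  arcs : List (V × V)
  arcs = filterᵇ isArc vpairs

  length-filterᵇ-arcs : ∀ (a b : V × V → Bool) →
    length (filterᵇ (λ e → a e ∧ b e ∧ isArc e) vpairs) ≡ length (filterᵇ (λ e → a e ∧ b e) arcs)
  length-filterᵇ-arcs a b = cong length (trans
    (filterᵇ-cong (λ e → trans (sym (∧-assoc (a e) (b e) (isArc e))) (∧-comm (a e ∧ b e) (isArc e))) vpairs)
    (filterᵇ-∧ (λ e → a e ∧ b e) isArc vpairs))

  ω⁺≡cut : ∀ C → ω⁺ C ≡ cut arcs C
  ω⁺≡cut C = length-filterᵇ-arcs (C ∘ proj₁) (not ∘ C ∘ proj₂)

  ω⁻≡cut∁ : ∀ C → ω⁻ C ≡ cut arcs (∁ C)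
  ω⁻≡cut∁ C = trans (length-filterᵇ-arcs (not ∘ C ∘ proj₁) (C ∘ proj₂))
    (cong length (filterᵇ-cong (λ e → cong (not (C (proj₁ e)) ∧_) (sym (not-involutive (C (proj₂ e))))) arcs))

  ∈-vertices : ∀ v → v ∈ vertices
  ∈-vertices (g , i) = ∈-cartesianProduct⁺ (∈-allFin g) (∈-allFin i)

  leaving-arcs : VSet → List (V × V)
  leaving-arcs C = filterᵇ (λ e → C (proj₁ e) ∧ not (C (proj₂ e)) ∧ isArc e) vpairs

  leaving-arcs-ArcSet : ∀ C → ArcSet (leaving-arcs C)
  leaving-arcs-ArcSet C =
    Unique.filter⁺ (T? ∘ leaving) (Unique.cartesianProduct⁺ unique-vertices unique-vertices) ,
    All.tabulate (λ {e} e∈ → ∧-conicalʳ (not (C (proj₂ e))) _ (∧-conicalʳ (C (proj₁ e)) _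
      (Equivalence.to T-≡ (proj₂ (∈-filter⁻ (T? ∘ leaving) {xs = vpairs} e∈)))))
    where
    leaving : V × V → Bool
    leaving e = C (proj₁ e) ∧ not (C (proj₂ e)) ∧ isArc e
    unique-vertices : Unique vertices
    unique-vertices = Unique.cartesianProduct⁺ (Unique.allFin⁺ _) (Unique.allFin⁺ _)

  ∈-leaving-arcs : ∀ C {u v} → C u ≡ true → C v ≡ false → Arc u v → (u , v) ∈ leaving-arcs C
  ∈-leaving-arcs C {u} {v} Cu Cv uv = ∈-filter⁺ _
    (∈-cartesianProduct⁺ (∈-vertices u) (∈-vertices v))
    (Equivalence.from T-≡ (trans (cong₂ (λ a b → a ∧ not b ∧ arcB u v) Cu Cv) uv))

  -- Were there fewer than λ arcs leaving C, X would stay strongly connected without them,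
  -- yet every path out of C uses one.
  arc-connectivity≤ω⁺ : IsArcConnectivity l → ∀ {C} → ProperNonempty C → l ≤ ω⁺ C
  arc-connectivity≤ω⁺ (_ , small-cuts-connect) {C} ((x , Cx) , (y , Cy)) = ≮⇒≥ λ ω⁺<l →
    let (u , v , (uv , uv∉) , Cu , Cv) =
          star-exit C (small-cuts-connect (leaving-arcs C) (leaving-arcs-ArcSet C) ω⁺<l x y) Cx Cy
    in uv∉ (∈-leaving-arcs C Cu Cv uv)

  arc-connectivity≤cut : IsArcConnectivity l → ∀ {C} → ProperNonempty C → l ≤ cut arcs C
  arc-connectivity≤cut conn {C} pn = subst (_ ≤_) (ω⁺≡cut C) (arc-connectivity≤ω⁺ conn pn)

  ∁-ProperNonempty : ∀ {C} → ProperNonempty C → ProperNonempty (∁ C)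
  ∁-ProperNonempty ((v , Cv) , (w , Cw)) = (w , cong not Cw) , (v , cong not Cv)

  positive-fragment : ∀ {A} → ProperNonempty A → cut arcs A ≡ l → Fragment l A
  positive-fragment {A = A} pn cutA = inj₁ (pn , trans (ω⁺≡cut A) cutA)

  negative-fragment : ∀ {A} → ProperNonempty A → cut arcs (∁ A) ≡ l → Fragment l A
  negative-fragment {A = A} pn cut∁A = inj₂ (pn , trans (ω⁻≡cut∁ A) cut∁A)

  full-or-missing : (C : VSet) → (∀ v → C v ≡ true) ⊎ ∃ λ w → C w ≡ false
  full-or-missing C with any? (λ w → C w Bool.≟ false) vertices
  ... | yes missing = inj₂ (satisfied missing)
  ... | no ¬missing = inj₁ λ v → ¬-not (¬missing ∘ lose (∈-vertices v))

  atom-⊆ : ∀ {A C} → Atom l A → Fragment l C → C ⊆ A → A ⊆ C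
  atom-⊆ (_ , minimal) fragC C⊆A = length-filterᵇ-≤⇒⊇ C⊆A (minimal _ fragC) (∈-vertices _)

  module AtomsDisjoint (l : ℕ) (f g : VSet → ℕ)
    (f-submodular : ∀ A B → f (A ∩ B) + f (A ∪ B) ≤ f A + f B)
    (l≤f : ∀ {C} → ProperNonempty C → l ≤ f C)
    (g∘∁≡f : ∀ A → g (∁ A) ≡ f A)
    (f-fragment : ∀ {A} → ProperNonempty A → f A ≡ l → Fragment l A)
    (g-fragment : ∀ {A} → ProperNonempty A → g A ≡ l → Fragment l A)
    where

    f-∩≡ : ∀ {A B} → f A ≡ l → f B ≡ l → ProperNonempty (A ∩ B) → ProperNonempty (A ∪ B) →
      f (A ∩ B) ≡ l
    f-∩≡ {A} {B} fA fB pn∩ pn∪ = ≤-antisym (+-cancelʳ-≤ l _ _ (begin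
      f (A ∩ B) + l          ≤⟨ +-monoʳ-≤ (f (A ∩ B)) (l≤f pn∪) ⟩
      f (A ∩ B) + f (A ∪ B)  ≤⟨ f-submodular A B ⟩
      f A + f B              ≡⟨ cong₂ _+_ fA fB ⟩
      l + l                  ∎)) (l≤f pn∩)
      where open ≤-Reasoning

    atoms-disjoint : ∀ {A B} → Atom l A → Atom l B → ProperNonempty A → f A ≡ l → f B ≡ l →
      ¬ SameSet A B → Disjoint A B
    atoms-disjoint {A} {B} atomA atomB pnA fA fB A≉B v (Av , Bv) with full-or-missing (A ∪ B)
    ... | inj₁ A∪B-full = contradiction (trans (cong not (sym Av)) (B⊆∁A Bv)) λ ()
      where
      ∁A⊆B : ∁ A ⊆ B
      ∁A⊆B {x} ∁Ax = subst (λ a → a ∨ B x ≡ true)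
        (trans (sym (not-involutive (A x))) (cong not ∁Ax)) (A∪B-full x)
      B⊆∁A : B ⊆ ∁ A
      B⊆∁A = atom-⊆ atomB (g-fragment (∁-ProperNonempty pnA) (trans (g∘∁≡f A) fA)) ∁A⊆B
    ... | inj₂ (w , A∪Bw) = A≉B (⊆-antisym A⊆B B⊆A)
      where
      Aw : A w ≡ false
      Aw = ∨-conicalˡ (A w) (B w) A∪Bw
      pn∩ : ProperNonempty (A ∩ B)
      pn∩ = (v , cong₂ _∧_ Av Bv) , (w , cong (_∧ B w) Aw)
      pn∪ : ProperNonempty (A ∪ B)
      pn∪ = (v , cong (_∨ B v) Av) , (w , A∪Bw)
      frag∩ : Fragment l (A ∩ B)
      frag∩ = f-fragment pn∩ (f-∩≡ fA fB pn∩ pn∪)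
      A⊆B : A ⊆ B
      A⊆B = ∩-⊆ʳ {A = A} {B = B} ∘ atom-⊆ atomA frag∩ (∩-⊆ˡ {A = A} {B = B})
      B⊆A : B ⊆ A
      B⊆A = ∩-⊆ˡ {A = A} {B = B} ∘ atom-⊆ atomB frag∩ (∩-⊆ʳ {A = A} {B = B})

  positive-atoms-disjoint : IsArcConnectivity l →
    ∀ A B → PosAtom l A → PosAtom l B → ¬ SameSet A B → Disjoint A B
  positive-atoms-disjoint {l} conn A B (atomA , pnA , ω⁺A) (atomB , _ , ω⁺B) =
    atoms-disjoint atomA atomB pnA (trans (sym (ω⁺≡cut A)) ω⁺A) (trans (sym (ω⁺≡cut B)) ω⁺B)
    where
    open AtomsDisjoint l (cut arcs) (cut arcs ∘ ∁) (cut-submodular arcs) (arc-connectivity≤cut conn)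
      (λ C → cut-cong arcs (not-involutive ∘ C)) positive-fragment negative-fragment

  negative-atoms-disjoint : IsArcConnectivity l →
    ∀ A B → NegAtom l A → NegAtom l B → ¬ SameSet A B → Disjoint A B
  negative-atoms-disjoint {l} conn A B (atomA , pnA , ω⁻A) (atomB , _ , ω⁻B) =
    atoms-disjoint atomA atomB pnA (trans (sym (ω⁻≡cut∁ A)) ω⁻A) (trans (sym (ω⁻≡cut∁ B)) ω⁻B)
    where
    open AtomsDisjoint l (cut arcs ∘ ∁) (cut arcs) (cut-∁-submodular arcs)
      (arc-connectivity≤cut conn ∘ ∁-ProperNonempty) (λ _ → refl) negative-fragment positive-fragment

corollary2p2 : (G : FinGroup) (S₀ S₁ T₀ T₁ : Subset (FinGroup.n G))
    → FinGroup.ε G ∉ S₀ → FinGroup.ε G ∉ S₁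
    → let open MD G S₀ S₁ T₀ T₁ in
      StronglyConnected Arc
    → (l d : ℕ) → IsArcConnectivity l → IsMinDegree d → l < d
    → (∀ A B → PosAtom l A → PosAtom l B → ¬ SameSet A B → Disjoint A B)
    × (∀ A B → NegAtom l A → NegAtom l B → ¬ SameSet A B → Disjoint A B)
corollary2p2 G S₀ S₁ T₀ T₁ _ _ _ l _ conn _ _ =
  positive-atoms-disjoint G S₀ S₁ T₀ T₁ conn , negative-atoms-disjoint G S₀ S₁ T₀ T₁ conn
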